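{- Let $\kappa$ be an infinite cardinal and let $G$ be an acyclic oriented graph. If $G$ has an infinite directed path or a vertex of degree $\kappa$, then $G$ is $\kappa$-avoidable. More specifically: (i) if $G$ has a vertex of in-degree $\kappa$ or an infinite backward directed path, then $G$ does not embed into $K_\kappa$; (ii) if $G$ has a vertex of out-degree $\kappa$ or an infinite forward directed path, then $G$ does not embed into $K_{\kappa^*}$.
   Context: Cardinals are identified with the least ordinal of that cardinality (von Neumann ordinals). For a strict total order $\tau=(V,\prec)$, $K_\tau$ is the tournament on $V$ with $(u,v)$ an edge iff $u\prec v$, and $K_{\tau^*}$ is the tournament on $V$ with $(u,v)$ an edge iff $u\succ v$; so $K_\kappa$ and $K_{\kappa^*}$ are these tournaments for the ordinal $\kappa$ with its usual order. The degree of a vertex is the number of edges incident with it. An embedding of $H$ into $G$ is an injection $\phi:V(H)\to V(G)$ with $(u,v)\in E(H)\Rightarrow(\phi(u),\phi(v))\in E(G)$. $G$ is $\kappa$-avoidable if there is a tournament $K$ with $|V(K)|=\kappa$ into which $G$ does not embed. A directed path is an orientation of a finite, one-way-infinite or two-way-infinite path with no vertex of in-degree 2 or out-degree 2; the infinite forward directed path is the one-way-infinite directed path with exactly one vertex of in-degree $0$ (i.e. $x_1\to x_2\to x_3\to\cdots$), and the infinite backward directed path is the one with exactly one vertex of out-degree $0$ (i.e. $\cdots\to x_3\to x_2\to x_1$). -}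

module Defs where

open import Level using (0ℓ)
open import Data.Nat using (ℕ; suc)
open import Data.Integer using (ℤ; _+_; +_)
open import Data.Product using (Σ; _×_; _,_; ∃)
open import Data.Sum using (_⊎_; inj₁; inj₂; swap)
open import Data.Empty using (⊥-elim)
open import Relation.Binary.Definitions using (tri<; tri≈; tri>)
open import Function using (flip)
open import Function.Definitions using (Injective)
open import Function.Bundles using (_↔_)
open import Relation.Nullary using (¬_)
open import Relation.Binary.PropositionalEquality using (_≡_; _≢_; refl)
open import Relation.Binary.Structures using (IsStrictTotalOrder)
open import Induction.WellFounded using (WellFounded)
open import Relation.Binary.Construct.Closure.Transitive using (TransClosure)

Below : {A : Set} → (A → A → Set) → A → Set
Below {A} _<_ a = Σ A (λ x → x < a)

-- An infinite cardinal κ, presented as (a copy of) the von Neumann ordinal κ: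
-- a well-order (A, <) that is an initial ordinal (no proper initial segment
-- has cardinality κ, i.e. A does not inject into any {x | x < a}) and infinite.
record InfiniteCardinal (A : Set) : Set₁ where
  field
    _<_          : A → A → Set
    isStrictTotalOrder : IsStrictTotalOrder _≡_ _<_
    wellFounded  : WellFounded _<_
    initial      : ∀ a → ¬ (Σ (A → Below _<_ a) (Injective _≡_ _≡_))
    infinite     : Σ (ℕ → A) (Injective _≡_ _≡_)

record OrientedGraph : Set₁ where
  field
    V       : Set
    E       : V → V → Set
    E-prop  : ∀ {u v} (p q : E u v) → p ≡ q
    irrefl  : ∀ v → ¬ E v v
    antisym : ∀ {u v} → E u v → ¬ E v u

module _ (G : OrientedGraph) where
  open OrientedGraph G

  Acyclic : Set
  Acyclic = ∀ v → ¬ TransClosure E v v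

  InDegree : V → Set → Set
  InDegree v A = A ↔ Σ V (λ u → E u v)

  OutDegree : V → Set → Set
  OutDegree v A = A ↔ Σ V (λ u → E v u)

  Degree : V → Set → Set
  Degree v A = A ↔ Σ V (λ u → E u v ⊎ E v u)

  ForwardPath : Set
  ForwardPath = Σ (ℕ → V) (λ x → Injective _≡_ _≡_ x × (∀ n → E (x n) (x (suc n))))

  BackwardPath : Set
  BackwardPath = Σ (ℕ → V) (λ x → Injective _≡_ _≡_ x × (∀ n → E (x (suc n)) (x n)))

  TwoWayPath : Set
  TwoWayPath = Σ (ℤ → V) (λ x → Injective _≡_ _≡_ x × (∀ i → E (x i) (x (i + + 1))))

  InfiniteDirectedPath : Set
  InfiniteDirectedPath = ForwardPath ⊎ BackwardPath ⊎ TwoWayPath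

record Tournament (A : Set) : Set₁ where
  field
    R       : A → A → Set
    irrefl  : ∀ v → ¬ R v v
    antisym : ∀ {u v} → R u v → ¬ R v u
    total   : ∀ {u v} → u ≢ v → R u v ⊎ R v u

EmbedsInto : OrientedGraph → {A : Set} → Tournament A → Set
EmbedsInto G K = Σ (V → _) (λ φ → Injective _≡_ _≡_ φ × (∀ {u v} → E u v → Tournament.R K (φ u) (φ v)))
  where open OrientedGraph G

Avoidable : OrientedGraph → Set → Set₁
Avoidable G A = Σ (Tournament A) (λ K → ¬ EmbedsInto G K)

module _ {A : Set} (κ : InfiniteCardinal A) where
  open InfiniteCardinal κ
  private module S = IsStrictTotalOrder isStrictTotalOrder

  Kκ : Tournament A
  Kκ = record
    { R = _<_
    ; irrefl = λ v p → S.irrefl refl p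
    ; antisym = λ p q → S.asym p q
    ; total = λ {u} {v} u≢v → tot u v u≢v }
    where
    tot : ∀ u v → u ≢ v → u < v ⊎ v < u
    tot u v ne with S.compare u v
    ... | tri< a _ _ = inj₁ a
    ... | tri≈ _ b _ = ⊥-elim (ne b)
    ... | tri> _ _ c = inj₂ c

  Kκ* : Tournament A
  Kκ* = record
    { R = flip _<_
    ; irrefl = Tournament.irrefl Kκ
    ; antisym = Tournament.antisym Kκ
    ; total = λ ne → swap (Tournament.total Kκ ne) }

{-# OPTIONS --safe #-}
-- An embedding of G into K_κ is an injection φ into the ordinal κ that increases along
-- edges, and one into K_κ* is one that decreases along edges. A backward path under φ
-- is an infinite descending sequence in a well-order, and the κ in-neighbours of v
-- would be injected into the initial segment below φ v, which is impossible because κ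
-- is an initial ordinal; (ii) is the mirror image. If v has degree κ and G embeds into
-- both tournaments, by φ and ψ, then its in-neighbours go below φ v under φ and its
-- out-neighbours below ψ v under ψ, so κ injects into two copies of an initial segment.
-- Writing ordinals as λ + n with λ a limit, the map λ + n ↦ λ + 2n, λ + 2n + 1 merges
-- the two copies into a single initial segment, contradicting initiality again.
module Submission where

open import Defs
open import Level using (0ℓ)
open import Axiom.ExcludedMiddle using (ExcludedMiddle)
open import Data.Empty using (⊥; ⊥-elim)
open import Data.Integer using (-[1+_])
open import Data.Integer.Properties using (-[1+-injective)
open import Data.Nat as ℕ using (ℕ; zero; suc; _*_; z≤n; s≤s)
import Data.Nat.Properties as ℕ
open import Data.Product using (Σ; ∃; _×_; _,_; proj₁; proj₂; map₂)
open import Data.Sum as Sum using (_⊎_; inj₁; inj₂; reduce)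
open import Data.Sum.Properties using (inj₁-injective; inj₂-injective)
open import Function using (_∘_)
open import Function.Bundles using (Injection; _↔_)
open import Function.Definitions using (Injective)
open import Function.Properties.Inverse using (↔⇒↣)
open import Induction.InfiniteDescent using (InfiniteDescendingSequence; Descent; descent∧wf⇒empty)
open import Induction.WellFounded using (WellFounded; Acc; acc)
open import Relation.Binary.Core using (Rel)
open import Relation.Binary.Definitions using (tri<; tri≈; tri>)
open import Relation.Binary.PropositionalEquality
open import Relation.Binary.Structures using (IsStrictTotalOrder)
open import Relation.Nullary using (¬_; yes; no)
open import Relation.Unary using (Pred)

reduce-map : ∀ {A B : Set} (f : A → B) s → reduce (Sum.map f f s) ≡ f (reduce s)
reduce-map f (inj₁ _) = refl
reduce-map f (inj₂ _) = refl

proj₁-injective : ∀ {A : Set} {P : A → Set} → (∀ {x} (p q : P x) → p ≡ q) →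
                  Injective _≡_ _≡_ (proj₁ {B = P})
proj₁-injective P-prop {x , p} {.x , q} refl = cong (x ,_) (P-prop p q)

interleave : ℕ ⊎ ℕ → ℕ
interleave (inj₁ n) = 2 * n
interleave (inj₂ n) = suc (2 * n)

interleave-injective : Injective _≡_ _≡_ interleave
interleave-injective {inj₁ m} {inj₁ n} eq = cong inj₁ (ℕ.*-cancelˡ-≡ m n 2 eq)
interleave-injective {inj₁ m} {inj₂ n} eq = ⊥-elim (ℕ.even≢odd m n eq)
interleave-injective {inj₂ m} {inj₁ n} eq = ⊥-elim (ℕ.even≢odd n m (sym eq))
interleave-injective {inj₂ m} {inj₂ n} eq = cong inj₂ (ℕ.*-cancelˡ-≡ m n 2 (ℕ.suc-injective eq))

interleave-< : ∀ s {m} → reduce s ℕ.< m → interleave s ℕ.< interleave (inj₁ m)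
interleave-< (inj₁ n) n<m = ℕ.*-monoʳ-< 2 n<m
interleave-< (inj₂ n) {m} n<m = subst (ℕ._≤ 2 * m) (ℕ.*-suc 2 n) (ℕ.*-monoʳ-≤ 2 n<m)

module HilbertHotel (em : ExcludedMiddle 0ℓ) {A : Set} {e : ℕ → A}
                   (e-injective : Injective _≡_ _≡_ e) where

  shift : A → A
  shift y with em {∃ λ k → e k ≡ y}
  ... | yes (k , _) = e (suc k)
  ... | no _        = y

  shift-injective : Injective _≡_ _≡_ shift
  shift-injective {y} {y′} eq with em {∃ λ k → e k ≡ y} | em {∃ λ k → e k ≡ y′}
  ... | yes (k , refl) | yes (k′ , refl) = cong e (ℕ.suc-injective (e-injective eq))
  ... | yes (k , refl) | no ∉            = ⊥-elim (∉ (suc k , eq))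
  ... | no ∉           | yes (k′ , refl) = ⊥-elim (∉ (suc k′ , sym eq))
  ... | no _           | no _            = eq

  shift≢e0 : ∀ y → shift y ≢ e 0
  shift≢e0 y with em {∃ λ k → e k ≡ y}
  ... | yes (k , _) = ℕ.1+n≢0 ∘ e-injective
  ... | no ∉        = λ y≡e0 → ∉ (0 , sym y≡e0)

  module _ (x : A) where

    redirect : A → A
    redirect z with em {z ≡ x}
    ... | yes _ = e 0
    ... | no _  = z

    redirect-injective : ∀ {z z′} → z ≢ e 0 → z′ ≢ e 0 →
                         redirect z ≡ redirect z′ → z ≡ z′
    redirect-injective {z} {z′} z≢e0 z′≢e0 eq with em {z ≡ x} | em {z′ ≡ x}
    ... | yes refl | yes refl = refl
    ... | yes _    | no _     = ⊥-elim (z′≢e0 (sym eq))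
    ... | no _     | yes _    = ⊥-elim (z≢e0 eq)
    ... | no _     | no _     = eq

    redirect≢ : ∀ {z} → z ≢ e 0 → redirect z ≢ x
    redirect≢ {z} z≢e0 with em {z ≡ x}
    ... | yes z≡x = λ e0≡x → z≢e0 (trans z≡x (sym e0≡x))
    ... | no z≢x  = z≢x

  -- shift frees the room e 0, and redirect moves the guest x into it.
  injectionAvoiding : ∀ x → Σ (A → A) λ f → Injective _≡_ _≡_ f × (∀ y → f y ≢ x)
  injectionAvoiding x =
    redirect x ∘ shift ,
    (λ eq → shift-injective (redirect-injective x (shift≢e0 _) (shift≢e0 _) eq)) ,
    (λ y → redirect≢ x (shift≢e0 y))

module WellOrder {A : Set} {_<_ : Rel A 0ℓ}
                 (isStrictTotalOrder : IsStrictTotalOrder _≡_ _<_)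
                 (wellFounded : WellFounded _<_) where

  open IsStrictTotalOrder isStrictTotalOrder renaming (trans to <-trans)
  open import Relation.Binary.Construct.StrictToNonStrict _≡_ _<_ as NonStrict using (_≤_)

  <-≤-trans : ∀ {x y z} → x < y → y ≤ z → x < z
  <-≤-trans = NonStrict.<-≤-trans <-trans <-respʳ-≈

  ≤-<-trans : ∀ {x y z} → x ≤ y → y < z → x < z
  ≤-<-trans = NonStrict.≤-<-trans sym <-trans (proj₂ <-resp-≈)

  ≮⇒≥ : ∀ {x y} → ¬ (y < x) → x ≤ y
  ≮⇒≥ {x} {y} y≮x with compare x y
  ... | tri< x<y _ _ = inj₁ x<y
  ... | tri≈ _ x≡y _ = inj₂ x≡y
  ... | tri> _ _ y<x = ⊥-elim (y≮x y<x)

  upperBound : ∀ a b → ∃ λ c → a ≤ c × b ≤ c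
  upperBound a b with compare a b
  ... | tri< a<b _ _ = b , inj₁ a<b , inj₂ refl
  ... | tri≈ _ a≡b _ = b , inj₂ a≡b , inj₂ refl
  ... | tri> _ _ b<a = a , inj₂ refl , inj₁ b<a

  noInfiniteDescendingSequence : ∀ f → ¬ InfiniteDescendingSequence _<_ f
  noInfiniteDescendingSequence f desc = descent∧wf⇒empty onSequence wellFounded (f 0) (0 , refl)
    where
    onSequence : Descent _<_ (λ x → ∃ λ n → f n ≡ x)
    onSequence (n , refl) = f (suc n) , desc n , suc n , refl

  module Classical (em : ExcludedMiddle 0ℓ) where

    minimal : (P : Pred A 0ℓ) → ∀ {y} → P y → ∃ λ m → P m × (∀ {z} → z < m → ¬ P z)
    minimal P {y} py = go (wellFounded y) py
      where
      go : ∀ {y} → Acc _<_ y → P y → ∃ λ m → P m × (∀ {z} → z < m → ¬ P z)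
      go {y} (acc rs) py with em {∃ λ z → z < y × P z}
      ... | yes (z , z<y , pz) = go (rs z<y) pz
      ... | no ∄               = y , py , λ z<y pz → ∄ (_ , z<y , pz)

    module Successor (unbounded : ∀ x → ∃ (x <_)) where

      private
        leastAbove : ∀ x → ∃ λ m → x < m × (∀ {z} → z < m → ¬ x < z)
        leastAbove x = minimal (x <_) (proj₂ (unbounded x))

      next : A → A
      next x = proj₁ (leastAbove x)

      x<next : ∀ x → x < next x
      x<next x = proj₁ (proj₂ (leastAbove x))

      next-least : ∀ {x z} → x < z → next x ≤ z
      next-least {x} x<z = ≮⇒≥ (λ z<next → proj₂ (proj₂ (leastAbove x)) z<next x<z)

      next-mono-< : ∀ {x y} → x < y → next x < next y
      next-mono-< {y = y} x<y = ≤-<-trans (next-least x<y) (x<next y)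

      next-injective : Injective _≡_ _≡_ next
      next-injective {x} {y} eq with compare x y
      ... | tri< x<y _ _ = ⊥-elim (irrefl eq (next-mono-< x<y))
      ... | tri≈ _ x≡y _ = x≡y
      ... | tri> _ _ y<x = ⊥-elim (irrefl (sym eq) (next-mono-< y<x))

      -- binds tighter than the parameter _<_, which has the default precedence 20
      infixl 30 _+ℕ_
      _+ℕ_ : A → ℕ → A
      l +ℕ zero  = l
      l +ℕ suc n = next (l +ℕ n)

      +ℕ-monoʳ-< : ∀ l {m n} → m ℕ.< n → l +ℕ m < l +ℕ n
      +ℕ-monoʳ-< l {m} {suc n} m<1+n with ℕ.m<1+n⇒m<n∨m≡n m<1+n
      ... | inj₁ m<n  = <-trans (+ℕ-monoʳ-< l m<n) (x<next _)
      ... | inj₂ refl = x<next _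

      l≤l+ℕn : ∀ l n → l ≤ l +ℕ n
      l≤l+ℕn l zero    = inj₂ refl
      l≤l+ℕn l (suc n) = inj₁ (+ℕ-monoʳ-< l {0} {suc n} (s≤s z≤n))

      NonSuccessor : Pred A 0ℓ
      NonSuccessor l = ∀ x → next x ≢ l

      +ℕ-<-nonSuccessor : ∀ {l μ} → NonSuccessor μ → l < μ → ∀ n → l +ℕ n < μ
      +ℕ-<-nonSuccessor μ-ns l<μ zero = l<μ
      +ℕ-<-nonSuccessor μ-ns l<μ (suc n) with next-least (+ℕ-<-nonSuccessor μ-ns l<μ n)
      ... | inj₁ lt = lt
      ... | inj₂ eq = ⊥-elim (μ-ns _ eq)

      +ℕ-injective : ∀ {l l′ m n} → NonSuccessor l → NonSuccessor l′ →
                     l +ℕ m ≡ l′ +ℕ n → l ≡ l′ × m ≡ n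
      +ℕ-injective {m = zero}  {zero}  _    _     eq = eq , refl
      +ℕ-injective {m = zero}  {suc n} l-ns _     eq = ⊥-elim (l-ns _ (sym eq))
      +ℕ-injective {m = suc m} {zero}  _    l′-ns eq = ⊥-elim (l′-ns _ eq)
      +ℕ-injective {m = suc m} {suc n} l-ns l′-ns eq =
        map₂ (cong suc) (+ℕ-injective l-ns l′-ns (next-injective eq))

      +ℕ-<-lex : ∀ {l μ m n} → NonSuccessor l → NonSuccessor μ →
                 l +ℕ m < μ +ℕ n → l < μ ⊎ (l ≡ μ × m ℕ.< n)
      +ℕ-<-lex {l} {μ} {m} {n} l-ns μ-ns lt with compare l μ
      ... | tri< l<μ _ _ = inj₁ l<μ
      ... | tri> _ _ μ<l =
        ⊥-elim (asym lt (<-≤-trans (+ℕ-<-nonSuccessor l-ns μ<l n) (l≤l+ℕn l m)))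
      ... | tri≈ _ refl _ with ℕ.<-cmp m n
      ...   | tri< m<n _ _ = inj₂ (refl , m<n)
      ...   | tri≈ _ refl _ = ⊥-elim (irrefl refl lt)
      ...   | tri> _ _ n<m = ⊥-elim (asym lt (+ℕ-monoʳ-< l n<m))

      decompose : ∀ x → ∃ λ l → NonSuccessor l × ∃ λ n → l +ℕ n ≡ x
      decompose x = go (wellFounded x)
        where
        go : ∀ {x} → Acc _<_ x → ∃ λ l → NonSuccessor l × ∃ λ n → l +ℕ n ≡ x
        go {x} (acc rs) with em {∃ λ z → next z ≡ x}
        ... | no ¬succ = x , (λ z eq → ¬succ (z , eq)) , 0 , refl
        ... | yes (z , refl) with go (rs (x<next z))
        ...   | l , l-ns , n , refl = l , l-ns , suc n , refl

      limitPart : A → A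
      limitPart x = proj₁ (decompose x)

      finitePart : A → ℕ
      finitePart x = proj₁ (proj₂ (proj₂ (decompose x)))

      limitPart-nonSuccessor : ∀ x → NonSuccessor (limitPart x)
      limitPart-nonSuccessor x = proj₁ (proj₂ (decompose x))

      limitPart+finitePart : ∀ x → limitPart x +ℕ finitePart x ≡ x
      limitPart+finitePart x = proj₂ (proj₂ (proj₂ (decompose x)))

      decompose-injective : ∀ {x y} → limitPart x ≡ limitPart y → finitePart x ≡ finitePart y →
                            x ≡ y
      decompose-injective {x} {y} l≡ n≡ = begin
        x                            ≡⟨ limitPart+finitePart x ⟨
        limitPart x +ℕ finitePart x  ≡⟨ cong₂ _+ℕ_ l≡ n≡ ⟩
        limitPart y +ℕ finitePart y  ≡⟨ limitPart+finitePart y ⟩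
        y                            ∎
        where open ≡-Reasoning

      <⇒lex : ∀ {x y} → x < y →
              limitPart x < limitPart y ⊎ (limitPart x ≡ limitPart y × finitePart x ℕ.< finitePart y)
      <⇒lex {x} {y} x<y =
        +ℕ-<-lex (limitPart-nonSuccessor x) (limitPart-nonSuccessor y)
          (subst₂ _<_ (sym (limitPart+finitePart x)) (sym (limitPart+finitePart y)) x<y)

      finiteParts : A ⊎ A → ℕ ⊎ ℕ
      finiteParts = Sum.map finitePart finitePart

      -- λ + n ↦ λ + 2n on the left copy and λ + 2n + 1 on the right one
      double : A ⊎ A → A
      double s = limitPart (reduce s) +ℕ interleave (finiteParts s)

      double-injective : Injective _≡_ _≡_ double
      double-injective {s} {t} eq
        with +ℕ-injective (limitPart-nonSuccessor _) (limitPart-nonSuccessor _) eq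
      ... | l≡ , i≡ = sameParts s t l≡ (interleave-injective i≡)
        where
        sameParts : ∀ s t → limitPart (reduce s) ≡ limitPart (reduce t) →
                    finiteParts s ≡ finiteParts t → s ≡ t
        sameParts (inj₁ x) (inj₁ y) l≡ n≡ = cong inj₁ (decompose-injective l≡ (inj₁-injective n≡))
        sameParts (inj₂ x) (inj₂ y) l≡ n≡ = cong inj₂ (decompose-injective l≡ (inj₂-injective n≡))
        sameParts (inj₁ x) (inj₂ y) _ ()
        sameParts (inj₂ x) (inj₁ y) _ ()

      double-< : ∀ s {c} → reduce s < c → double s < double (inj₁ c)
      double-< s {c} s<c with <⇒lex s<c
      ... | inj₁ l<l′ =
        <-≤-trans (+ℕ-<-nonSuccessor (limitPart-nonSuccessor c) l<l′ (interleave (finiteParts s)))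
                  (l≤l+ℕn _ (interleave (inj₁ (finitePart c))))
      ... | inj₂ (l≡l′ , n<n′) rewrite l≡l′ =
        +ℕ-monoʳ-< _ (interleave-< (finiteParts s)
                       (subst (ℕ._< finitePart c) (sym (reduce-map finitePart s)) n<n′))

module InitialOrdinal {A : Set} (κ : InfiniteCardinal A) where
  open InfiniteCardinal κ
  open WellOrder isStrictTotalOrder wellFounded public

  noBoundedInjection : ∀ c (f : A → A) → Injective _≡_ _≡_ f → (∀ a → f a < c) → ⊥
  noBoundedInjection c f f-injective f<c =
    initial c ((λ a → f a , f<c a) , f-injective ∘ cong proj₁)

  module _ (em : ExcludedMiddle 0ℓ) where

    unbounded : ∀ x → ∃ (x <_)
    unbounded x with em {∃ (x <_)}
    ... | yes above = above
    ... | no ∄ = ⊥-elim (noBoundedInjection x f f-injective f<x)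
      where
      open HilbertHotel em (proj₂ infinite)
      f : A → A
      f = proj₁ (injectionAvoiding x)

      f-injective : Injective _≡_ _≡_ f
      f-injective = proj₁ (proj₂ (injectionAvoiding x))

      f<x : ∀ a → f a < x
      f<x a with ≮⇒≥ (λ x<fa → ∄ (_ , x<fa))
      ... | inj₁ fa<x = fa<x
      ... | inj₂ fa≡x = ⊥-elim (proj₂ (proj₂ (injectionAvoiding x)) a fa≡x)

    open Classical em
    open Successor unbounded

    noBoundedInjection-⊎ : ∀ c (g : A → A ⊎ A) → Injective _≡_ _≡_ g →
                           (∀ a → reduce (g a) < c) → ⊥
    noBoundedInjection-⊎ c g g-injective g<c =
      noBoundedInjection (double (inj₁ c)) (double ∘ g) (g-injective ∘ double-injective)
                         (λ a → double-< (g a) (g<c a))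

twoWayPath⇒backwardPath : ∀ G → TwoWayPath G → BackwardPath G
twoWayPath⇒backwardPath G (x , x-injective , x-edge) =
  (λ n → x -[1+ n ]) , -[1+-injective ∘ x-injective , (λ n → x-edge -[1+ suc n ])

module _ {A : Set} (κ : InfiniteCardinal A) (G : OrientedGraph) where
  open InfiniteCardinal κ using (_<_)
  open OrientedGraph G
  open InitialOrdinal κ

  noBoundedNeighbourhood : ∀ {N : V → Set} → (∀ {u} (p q : N u) → p ≡ q) → A ↔ Σ V N →
                           (φ : V → A) → Injective _≡_ _≡_ φ →
                           ∀ c → (∀ {u} → N u → φ u < c) → ⊥
  noBoundedNeighbourhood N-prop iso φ φ-injective c φ<c =
    noBoundedInjection c (φ ∘ proj₁ ∘ to) (to-injective ∘ proj₁-injective N-prop ∘ φ-injective)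
                       (φ<c ∘ proj₂ ∘ to)
    where open Injection (↔⇒↣ iso) renaming (injective to to-injective)

  inDegree⊎backwardPath⇒¬embedsIntoKκ : Σ V (λ v → InDegree G v A) ⊎ BackwardPath G →
                                        ¬ EmbedsInto G (Kκ κ)
  inDegree⊎backwardPath⇒¬embedsIntoKκ (inj₁ (v , iso)) (φ , φ-injective , φ-edge) =
    noBoundedNeighbourhood E-prop iso φ φ-injective (φ v) φ-edge
  inDegree⊎backwardPath⇒¬embedsIntoKκ (inj₂ (x , _ , x-edge)) (φ , _ , φ-edge) =
    noInfiniteDescendingSequence (φ ∘ x) (φ-edge ∘ x-edge)

  outDegree⊎forwardPath⇒¬embedsIntoKκ* : Σ V (λ v → OutDegree G v A) ⊎ ForwardPath G →
                                         ¬ EmbedsInto G (Kκ* κ)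
  outDegree⊎forwardPath⇒¬embedsIntoKκ* (inj₁ (v , iso)) (φ , φ-injective , φ-edge) =
    noBoundedNeighbourhood E-prop iso φ φ-injective (φ v) φ-edge
  outDegree⊎forwardPath⇒¬embedsIntoKκ* (inj₂ (x , _ , x-edge)) (φ , _ , φ-edge) =
    noInfiniteDescendingSequence (φ ∘ x) (φ-edge ∘ x-edge)

  adjacent-prop : ∀ {u v} (p q : E u v ⊎ E v u) → p ≡ q
  adjacent-prop (inj₁ p) (inj₁ q) = cong inj₁ (E-prop p q)
  adjacent-prop (inj₁ p) (inj₂ q) = ⊥-elim (antisym p q)
  adjacent-prop (inj₂ p) (inj₁ q) = ⊥-elim (antisym p q)
  adjacent-prop (inj₂ p) (inj₂ q) = cong inj₂ (E-prop p q)

  degree∧embedsIntoKκ⇒¬embedsIntoKκ* : ExcludedMiddle 0ℓ → ∀ v → Degree G v A →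
                                        EmbedsInto G (Kκ κ) → ¬ EmbedsInto G (Kκ* κ)
  degree∧embedsIntoKκ⇒¬embedsIntoKκ* em v iso (φ , φ-injective , φ-edge) (ψ , ψ-injective , ψ-edge) =
    noBoundedInjection-⊎ em c (split ∘ to) (to-injective ∘ split-injective) (split<c ∘ to)
    where
    open Injection (↔⇒↣ iso) renaming (injective to to-injective)
    c : A
    c = proj₁ (upperBound (φ v) (ψ v))

    split : Σ V (λ u → E u v ⊎ E v u) → A ⊎ A
    split (u , inj₁ _) = inj₁ (φ u)
    split (u , inj₂ _) = inj₂ (ψ u)

    split-injective : Injective _≡_ _≡_ split
    split-injective {_ , inj₁ _} {_ , inj₁ _} eq =
      proj₁-injective adjacent-prop (φ-injective (inj₁-injective eq))
    split-injective {_ , inj₂ _} {_ , inj₂ _} eq =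
      proj₁-injective adjacent-prop (ψ-injective (inj₂-injective eq))
    split-injective {_ , inj₁ _} {_ , inj₂ _} ()
    split-injective {_ , inj₂ _} {_ , inj₁ _} ()

    split<c : ∀ p → reduce (split p) < c
    split<c (_ , inj₁ uv) = <-≤-trans (φ-edge uv) (proj₁ (proj₂ (upperBound (φ v) (ψ v))))
    split<c (_ , inj₂ vu) = <-≤-trans (ψ-edge vu) (proj₂ (proj₂ (upperBound (φ v) (ψ v))))

  avoidable : ExcludedMiddle 0ℓ → InfiniteDirectedPath G ⊎ Σ V (λ v → Degree G v A) →
              Avoidable G A
  avoidable _ (inj₁ (inj₁ forward)) =
    Kκ* κ , outDegree⊎forwardPath⇒¬embedsIntoKκ* (inj₂ forward)
  avoidable _ (inj₁ (inj₂ (inj₁ backward))) =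
    Kκ κ , inDegree⊎backwardPath⇒¬embedsIntoKκ (inj₂ backward)
  avoidable _ (inj₁ (inj₂ (inj₂ twoWay))) =
    Kκ κ , inDegree⊎backwardPath⇒¬embedsIntoKκ (inj₂ (twoWayPath⇒backwardPath G twoWay))
  avoidable em (inj₂ (v , iso)) with em {EmbedsInto G (Kκ κ)}
  ... | yes embedding  = Kκ* κ , degree∧embedsIntoKκ⇒¬embedsIntoKκ* em v iso embedding
  ... | no ¬embedding = Kκ κ , ¬embedding

mainTheorem6 : (A : Set) (κ : InfiniteCardinal A) (G : OrientedGraph) → Acyclic G →
    -- (i)
    ((Σ (OrientedGraph.V G) (λ v → InDegree G v A) ⊎ BackwardPath G) → ¬ EmbedsInto G (Kκ κ))
    -- (ii)
    × ((Σ (OrientedGraph.V G) (λ v → OutDegree G v A) ⊎ ForwardPath G) → ¬ EmbedsInto G (Kκ* κ))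
    -- main claim (classical cardinal arithmetic: ambient excluded middle)
    × (ExcludedMiddle 0ℓ →
        (InfiniteDirectedPath G ⊎ Σ (OrientedGraph.V G) (λ v → Degree G v A)) → Avoidable G A)
mainTheorem6 A κ G _ =
  inDegree⊎backwardPath⇒¬embedsIntoKκ κ G ,
  outDegree⊎forwardPath⇒¬embedsIntoKκ* κ G ,
  avoidable κ G
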